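{- For all $n\ge 0$ we have $\left\lfloor \frac{\varphi+2}{5}\,n\right\rfloor \le a(n)\le \lfloor \varphi n\rfloor$.
   Context: $\varphi=(1+\sqrt5)/2$. Fibonacci numbers: $F_0=0$, $F_1=1$, $F_n=F_{n-1}+F_{n-2}$. The sequence $(a(n))_{n\geq 0}$ (OEIS A105774) is defined by $a(n)=n$ for $n\le 1$, and $a(n)=F_{j+1}-a(n-F_j)$ if $F_j<n\le F_{j+1}$ with $j\ge 2$. -}

module Defs where

open import Data.Nat using (ℕ; zero; suc; _+_; _*_; _∸_; _^_; _≤ᵇ_)
open import Data.Bool using (Bool; true; false; if_then_else_; _∨_)
open import Data.Integer as ℤ using (ℤ; +_)

fib : ℕ → ℕ
fib zero = 0
fib (suc zero) = 1
fib (suc (suc n)) = fib (suc n) + fib n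

findJ : ℕ → ℕ → ℕ → ℕ
findJ zero n j = j
findJ (suc k) n j = if n ≤ᵇ fib (suc j) then j else findJ k n (suc j)

jOf : ℕ → ℕ
jOf n = findJ (suc n) n 2

-- a(n) with fuel; a(n) = n for n ≤ 1,
-- a(n) = F_{j+1} - a(n - F_j) for F_j < n ≤ F_{j+1}, j ≥ 2.
-- Fuel n suffices since n - F_j < n.
aFuel : ℕ → ℕ → ℤ
aFuel zero n = + n
aFuel (suc f) n =
  if n ≤ᵇ 1 then + n
  else (+ fib (suc (jOf n))) ℤ.- aFuel f (n ∸ fib (jOf n))

-- OEIS A105774
a : ℕ → ℤ
a n = aFuel (suc n) n

-- Exact comparison m ≤ φ n, φ = (1+√5)/2:
--   m ≤ φ n  ⇔  2m - n ≤ √5 n  ⇔  2m ≤ n  ∨  (2m - n)² ≤ 5 n²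
leφ : ℕ → ℕ → Bool
leφ m n = ((2 * m) ≤ᵇ n) ∨ (((2 * m ∸ n) ^ 2) ≤ᵇ (5 * n ^ 2))

-- Exact comparison m ≤ ((φ+2)/5) n = ((5+√5)/10) n:
--   ⇔ 10m - 5n ≤ √5 n ⇔ 10m ≤ 5n ∨ (10m - 5n)² ≤ 5 n²
leC : ℕ → ℕ → Bool
leC m n = ((10 * m) ≤ᵇ (5 * n)) ∨ (((10 * m ∸ 5 * n) ^ 2) ≤ᵇ (5 * n ^ 2))

-- largest m ≤ B with p m (p is downward closed and p 0 holds in our uses)
largestBelow : (ℕ → Bool) → ℕ → ℕ
largestBelow p zero = zero
largestBelow p (suc B) = if p (suc B) then suc B else largestBelow p B

-- ⌊φ n⌋ : φ n < 2n + 1, so searching m ≤ 2n suffices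
floorφ : ℕ → ℕ
floorφ n = largestBelow (λ m → leφ m n) (2 * n)

-- ⌊((φ+2)/5) n⌋ : (φ+2)/5 < 1, so searching m ≤ n suffices
floorC : ℕ → ℕ
floorC n = largestBelow (λ m → leC m n) n

-- Work in ℤ[φ] ordered as a subring of ℝ: x ≥ 0 is certified by a k with
-- φᵏx having nonnegative coordinates, which makes the cone closed under + and
-- ×; such a certificate is turned back into integer inequalities through the
-- norm p² + pq - q² of p + qφ.
--
-- Write δ(n) = 5a(n) - (φ + 2)n + 4.  Applying the recursion twice gives
-- a(F_j + F_k + m) = F_(j+1) - F_(k+1) + a(m) for 1 ≤ m ≤ F_(k-1) and
-- F_k + m ≤ F_(j-1), hence δ(F_j + F_k + m) = A_j - B_k + δ(m) with
-- A_j = 5F_(j+1) - (φ + 2)F_j, which increases with j, B_k = 5F_(k+1) + (φ + 2)F_k,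
-- and A_(k+2) - B_k = (φ + 2)ψ^(k+2) for ψ = 1 - φ = -φ⁻¹.  Strong induction
-- gives δ(n) ≥ φ^-t whenever n ≤ F_(t+1): the margin φ^-(k-2) inherited from m
-- pays for (φ + 2)ψ^(k+2) ≥ -(φ + 2)φ^-(k+2) because φ⁴ ≥ φ + 3.  So
-- 5a(n) > (φ + 2)n - 5, which is the lower bound, and in particular a ≥ 0.  The
-- upper bound needs no induction: nφ - a(F_j + m) = a(m) + mφ - ψ^j ≥ φ - 1 ≥ 0.

module Submission where

open import Defs
open import Data.Nat using (ℕ)
open import Data.Integer using (_≤_; +_)
open import Data.Product using (_×_)

open import Data.Bool using (T; true; false)
open import Data.Bool.Properties using (T-∨)
open import Data.Empty using (⊥; ⊥-elim)
open import Data.Integer as ℤ using (ℤ; 0ℤ; -[1+_]; +≤+; _+_; _-_; _*_; -_)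
import Data.Integer.Properties as ℤ
open import Data.Integer.Tactic.RingSolver using (solve)
open import Data.List using (_∷_; [])
open import Data.Nat as ℕ using (zero; suc; z≤n; s≤s; _≤′_; ≤′-refl; ≤′-step)
open import Data.Nat.Induction using (<-rec)
import Data.Nat.Properties as ℕ
open import Data.Product using (∃-syntax; _,_)
open import Data.Sum using (_⊎_; inj₁; inj₂)
open import Data.Unit using (tt)
open import Function.Bundles using (Equivalence; _⇔_; mk⇔)
open import Relation.Binary.Bundles using (Preorder)
open import Relation.Binary.Definitions using (tri<; tri≈; tri>)
open import Relation.Binary.PropositionalEquality
import Relation.Binary.Reasoning.Preorder
open import Relation.Nullary using (¬_; Dec; yes; no)

0≤+ : ∀ n → 0ℤ ≤ + n
0≤+ _ = +≤+ z≤n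

0≤-+ : ∀ {i j} → 0ℤ ≤ i → 0ℤ ≤ j → 0ℤ ≤ i + j
0≤-+ = ℤ.+-mono-≤

0≤-* : ∀ {i j} → 0ℤ ≤ i → 0ℤ ≤ j → 0ℤ ≤ i * j
0≤-* {+ m} {+ n} _ _ = subst (0ℤ ≤_) (ℤ.pos-* m n) (0≤+ (m ℕ.* n))

≤0⇒0≤- : ∀ {i} → i ≤ 0ℤ → 0ℤ ≤ - i
≤0⇒0≤- = ℤ.neg-mono-≤

0≤-⇒≤0 : ∀ {i} → 0ℤ ≤ - i → i ≤ 0ℤ
0≤-⇒≤0 {i} h = subst (_≤ 0ℤ) (ℤ.neg-involutive i) (ℤ.neg-mono-≤ h)

-- The hypothesis comes first so that i is known when the ring solver is asked
-- for i ≡ j.  The solver abstracts only variables, which is why identities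
-- about concrete terms are stated for variables in local lemmas below.
0≤-by : ∀ {i j} → 0ℤ ≤ i → i ≡ j → 0ℤ ≤ j
0≤-by h refl = h

-- Opaque so that unfolding a refutation never normalises ring-solver proofs.
opaque
  0≤-absurd : ∀ {i n} → 0ℤ ≤ i → i ≡ -[1+ n ] → ⊥
  0≤-absurd () refl

0≤5i+4⇒0≤i : ∀ i → 0ℤ ≤ + 5 * i + + 4 → 0ℤ ≤ i
0≤5i+4⇒0≤i (+ m) _ = 0≤+ m
0≤5i+4⇒0≤i -[1+ m ] h = refute (+ m) (0≤+ m) h
  where
  refute : ∀ j → 0ℤ ≤ j → 0ℤ ≤ + 5 * (- (+ 1 + j)) + + 4 → 0ℤ ≤ -[1+ m ]
  refute j 0≤j h = ⊥-elim (0≤-absurd {n = 0} (0≤-+ h (0≤-* (0≤+ 5) 0≤j)) (solve (j ∷ [])))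

pos-∸ : ∀ {m n} → n ℕ.≤ m → + (m ℕ.∸ n) ≡ + m - + n
pos-∸ {m} {n} n≤m = sym (trans (ℤ.m-n≡m⊖n m n) (ℤ.⊖-≥ n≤m))

pos-square : ∀ m → + (m ℕ.^ 2) ≡ + m * + m
pos-square m = trans (ℤ.pos-* m (m ℕ.* 1)) (cong (λ k → + m * + k) (ℕ.*-identityʳ m))

-- The ring ℤ[φ] and its nonnegative cone

infixl 6 _⊞_ _⊟_
infixl 7 _⊠_
infix 8 ⊟_
infixr 9 _^_
infix 4 0≼_ _≼_

-- ⟨ p , q ⟩ is p + qφ, where φ² = φ + 1.
data ℤ[φ] : Set where
  ⟨_,_⟩ : ℤ → ℤ → ℤ[φ]

≡-⟨,⟩ : ∀ {p q p′ q′} → p ≡ p′ → q ≡ q′ → ⟨ p , q ⟩ ≡ ⟨ p′ , q′ ⟩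
≡-⟨,⟩ = cong₂ ⟨_,_⟩

fromℤ : ℤ → ℤ[φ]
fromℤ z = ⟨ z , 0ℤ ⟩

0φ 1φ φ φ⁻¹ ψ : ℤ[φ]
0φ = fromℤ 0ℤ
1φ = fromℤ (+ 1)
φ = ⟨ 0ℤ , + 1 ⟩
φ⁻¹ = ⟨ - + 1 , + 1 ⟩
ψ = ⟨ + 1 , - + 1 ⟩

_⊞_ : ℤ[φ] → ℤ[φ] → ℤ[φ]
⟨ p , q ⟩ ⊞ ⟨ r , s ⟩ = ⟨ p + r , q + s ⟩

⊟_ : ℤ[φ] → ℤ[φ]
⊟ ⟨ p , q ⟩ = ⟨ - p , - q ⟩

_⊟_ : ℤ[φ] → ℤ[φ] → ℤ[φ]
x ⊟ y = x ⊞ ⊟ y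

_⊠_ : ℤ[φ] → ℤ[φ] → ℤ[φ]
⟨ p , q ⟩ ⊠ ⟨ r , s ⟩ = ⟨ p * r + q * s , p * s + q * r + q * s ⟩

_^_ : ℤ[φ] → ℕ → ℤ[φ]
x ^ zero = 1φ
x ^ suc k = x ⊠ x ^ k

⊠-identityˡ : ∀ x → 1φ ⊠ x ≡ x
⊠-identityˡ ⟨ p , q ⟩ = ≡-⟨,⟩ (solve (p ∷ q ∷ [])) (solve (p ∷ q ∷ []))

⊠-assoc : ∀ x y z → (x ⊠ y) ⊠ z ≡ x ⊠ (y ⊠ z)
⊠-assoc ⟨ p , q ⟩ ⟨ r , s ⟩ ⟨ u , v ⟩ =
  ≡-⟨,⟩ (solve (p ∷ q ∷ r ∷ s ∷ u ∷ v ∷ [])) (solve (p ∷ q ∷ r ∷ s ∷ u ∷ v ∷ []))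

^-+ : ∀ x k l → x ^ (k ℕ.+ l) ≡ x ^ k ⊠ x ^ l
^-+ x zero l = sym (⊠-identityˡ (x ^ l))
^-+ x (suc k) l = trans (cong (x ⊠_) (^-+ x k l)) (sym (⊠-assoc x (x ^ k) (x ^ l)))

NonNegCoords : ℤ[φ] → Set
NonNegCoords ⟨ p , q ⟩ = 0ℤ ≤ p × 0ℤ ≤ q

NonNegCoords-⊞ : ∀ x y → NonNegCoords x → NonNegCoords y → NonNegCoords (x ⊞ y)
NonNegCoords-⊞ ⟨ _ , _ ⟩ ⟨ _ , _ ⟩ (p , q) (r , s) = 0≤-+ p r , 0≤-+ q s

NonNegCoords-⊠ : ∀ x y → NonNegCoords x → NonNegCoords y → NonNegCoords (x ⊠ y)
NonNegCoords-⊠ ⟨ _ , _ ⟩ ⟨ _ , _ ⟩ (p , q) (r , s) =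
  0≤-+ (0≤-* p r) (0≤-* q s) , 0≤-+ (0≤-+ (0≤-* p s) (0≤-* q r)) (0≤-* q s)

NonNegCoords-φ^ : ∀ k → NonNegCoords (φ ^ k)
NonNegCoords-φ^ zero = 0≤+ _ , 0≤+ _
NonNegCoords-φ^ (suc k) = NonNegCoords-⊠ φ (φ ^ k) (0≤+ _ , 0≤+ _) (NonNegCoords-φ^ k)

-- x ≥ 0 in ℝ iff φᵏx has nonnegative coordinates for some k; only the "if"
-- direction is needed, see 0≼-sound.
0≼_ : ℤ[φ] → Set
0≼ x = ∃[ k ] NonNegCoords (φ ^ k ⊠ x)

-- A record rather than 0≼ y ⊟ x, so that x and y can be inferred from x ≼ y.
record _≼_ (x y : ℤ[φ]) : Set where
  constructor from-0≼
  field to-0≼ : 0≼ y ⊟ x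

0≼-coords : ∀ {x} → NonNegCoords x → 0≼ x
0≼-coords {x} h = 0 , subst NonNegCoords (sym (⊠-identityˡ x)) h

0≼-⊞ : ∀ {x y} → 0≼ x → 0≼ y → 0≼ x ⊞ y
0≼-⊞ {x} {y} (k , hx) (l , hy) = k ℕ.+ l ,
  subst NonNegCoords (sym (trans (cong (_⊠ (x ⊞ y)) (^-+ φ k l)) (shift (φ ^ k) (φ ^ l) x y)))
    (NonNegCoords-⊞ _ _ (NonNegCoords-⊠ (φ ^ l) _ (NonNegCoords-φ^ l) hx)
                        (NonNegCoords-⊠ (φ ^ k) _ (NonNegCoords-φ^ k) hy))
  where
  shift : ∀ u v x y → (u ⊠ v) ⊠ (x ⊞ y) ≡ v ⊠ (u ⊠ x) ⊞ u ⊠ (v ⊠ y)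
  shift ⟨ a , b ⟩ ⟨ c , d ⟩ ⟨ p , q ⟩ ⟨ r , s ⟩ =
    ≡-⟨,⟩ (solve (a ∷ b ∷ c ∷ d ∷ p ∷ q ∷ r ∷ s ∷ []))
          (solve (a ∷ b ∷ c ∷ d ∷ p ∷ q ∷ r ∷ s ∷ []))

0≼-⊠ : ∀ {x y} → 0≼ x → 0≼ y → 0≼ x ⊠ y
0≼-⊠ {x} {y} (k , hx) (l , hy) = k ℕ.+ l ,
  subst NonNegCoords (sym (trans (cong (_⊠ (x ⊠ y)) (^-+ φ k l)) (shift (φ ^ k) (φ ^ l) x y)))
    (NonNegCoords-⊠ _ _ hx hy)
  where
  shift : ∀ u v x y → (u ⊠ v) ⊠ (x ⊠ y) ≡ (u ⊠ x) ⊠ (v ⊠ y)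
  shift ⟨ a , b ⟩ ⟨ c , d ⟩ ⟨ p , q ⟩ ⟨ r , s ⟩ =
    ≡-⟨,⟩ (solve (a ∷ b ∷ c ∷ d ∷ p ∷ q ∷ r ∷ s ∷ []))
          (solve (a ∷ b ∷ c ∷ d ∷ p ∷ q ∷ r ∷ s ∷ []))

0≼-0φ : 0≼ 0φ
0≼-0φ = 0≼-coords (0≤+ _ , 0≤+ _)

≼-reflexive : ∀ {x y} → x ≡ y → x ≼ y
≼-reflexive {x} refl = from-0≼ (subst 0≼_ (sym (x⊟x≡0 x)) 0≼-0φ)
  where
  x⊟x≡0 : ∀ x → x ⊟ x ≡ 0φ
  x⊟x≡0 ⟨ p , q ⟩ = ≡-⟨,⟩ (ℤ.+-inverseʳ p) (ℤ.+-inverseʳ q)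

≼-trans : ∀ {x y z} → x ≼ y → y ≼ z → x ≼ z
≼-trans {x} {y} {z} (from-0≼ x≼y) (from-0≼ y≼z) =
  from-0≼ (subst 0≼_ (telescope x y z) (0≼-⊞ y≼z x≼y))
  where
  telescope : ∀ x y z → (z ⊟ y) ⊞ (y ⊟ x) ≡ z ⊟ x
  telescope ⟨ p , q ⟩ ⟨ r , s ⟩ ⟨ u , v ⟩ =
    ≡-⟨,⟩ (solve (p ∷ r ∷ u ∷ [])) (solve (q ∷ s ∷ v ∷ []))

≼-preorder : Preorder _ _ _
≼-preorder = record
  { Carrier = ℤ[φ] ; _≈_ = _≡_ ; _≲_ = _≼_
  ; isPreorder = record { isEquivalence = isEquivalence ; reflexive = ≼-reflexive ; trans = ≼-trans }
  }

⊞-mono-≼ : ∀ {x y u v} → x ≼ y → u ≼ v → x ⊞ u ≼ y ⊞ v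
⊞-mono-≼ {x} {y} {u} {v} (from-0≼ x≼y) (from-0≼ u≼v) =
  from-0≼ (subst 0≼_ (regroup x y u v) (0≼-⊞ x≼y u≼v))
  where
  regroup : ∀ x y u v → (y ⊟ x) ⊞ (v ⊟ u) ≡ (y ⊞ v) ⊟ (x ⊞ u)
  regroup ⟨ a , b ⟩ ⟨ c , d ⟩ ⟨ p , q ⟩ ⟨ r , s ⟩ =
    ≡-⟨,⟩ (solve (a ∷ c ∷ p ∷ r ∷ [])) (solve (b ∷ d ∷ q ∷ s ∷ []))

⊞-monoˡ-≼ : ∀ {x y} z → x ≼ y → x ⊞ z ≼ y ⊞ z
⊞-monoˡ-≼ z x≼y = ⊞-mono-≼ x≼y (≼-reflexive {z} refl)

≼-⊞ʳ : ∀ {x d} → 0≼ d → x ≼ x ⊞ d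
≼-⊞ʳ {x} {d} h = from-0≼ (subst 0≼_ (sym (cancel x d)) h)
  where
  cancel : ∀ x d → (x ⊞ d) ⊟ x ≡ d
  cancel ⟨ p , q ⟩ ⟨ r , s ⟩ = ≡-⟨,⟩ (solve (p ∷ r ∷ [])) (solve (q ∷ s ∷ []))

0≼-≼ : ∀ {x y} → 0≼ x → x ≼ y → 0≼ y
0≼-≼ {x} {y} 0≼x (from-0≼ x≼y) = subst 0≼_ (cancel x y) (0≼-⊞ x≼y 0≼x)
  where
  cancel : ∀ x y → (y ⊟ x) ⊞ x ≡ y
  cancel ⟨ p , q ⟩ ⟨ r , s ⟩ = ≡-⟨,⟩ (solve (p ∷ r ∷ [])) (solve (q ∷ s ∷ []))

-- p + qφ ≥ 0 in ℝ.  When p and q have opposite signs, the conjugate p + qψ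
-- has the sign of p, so the sign of p + qφ is that of p times the norm
-- (p + qφ)(p + qψ) = p² + pq - q².
data NonNegReal (p q : ℤ) : Set where
  both-nonneg  : 0ℤ ≤ p → 0ℤ ≤ q → NonNegReal p q
  p-dominates  : 0ℤ ≤ p → q ≤ 0ℤ → 0ℤ ≤ p * p + p * q - q * q → NonNegReal p q
  qφ-dominates : p ≤ 0ℤ → 0ℤ ≤ q → p * p + p * q - q * q ≤ 0ℤ → NonNegReal p q

NonNegReal-cancel-φ : ∀ p q → NonNegReal q (p + q) → NonNegReal p q
NonNegReal-cancel-φ p q (both-nonneg 0≤q 0≤p+q) with ℤ.≤-total 0ℤ p
... | inj₁ 0≤p = both-nonneg 0≤p 0≤q
... | inj₂ p≤0 = qφ-dominates p≤0 0≤q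
  (0≤-⇒≤0 (0≤-by (0≤-+ (0≤-* (≤0⇒0≤- p≤0) 0≤p+q) (0≤-* 0≤q 0≤q)) (solve (p ∷ q ∷ []))))
NonNegReal-cancel-φ p q (p-dominates 0≤q p+q≤0 0≤N) = qφ-dominates
  (0≤-⇒≤0 (0≤-by (0≤-+ (≤0⇒0≤- p+q≤0) 0≤q) (solve (p ∷ q ∷ []))))
  0≤q
  (0≤-⇒≤0 (0≤-by 0≤N (solve (p ∷ q ∷ []))))
NonNegReal-cancel-φ p q (qφ-dominates q≤0 0≤p+q N≤0) = p-dominates
  (0≤-by (0≤-+ 0≤p+q (≤0⇒0≤- q≤0)) (solve (p ∷ q ∷ [])))
  q≤0
  (0≤-by (≤0⇒0≤- N≤0) (solve (p ∷ q ∷ [])))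

0≼-sound : ∀ {p q} → 0≼ ⟨ p , q ⟩ → NonNegReal p q
0≼-sound {p} {q} (k , h) = go k p q h
  where
  go : ∀ k p q → NonNegCoords (φ ^ k ⊠ ⟨ p , q ⟩) → NonNegReal p q
  go zero p q h with subst NonNegCoords (⊠-identityˡ ⟨ p , q ⟩) h
  ... | 0≤p , 0≤q = both-nonneg 0≤p 0≤q
  go (suc k) p q h = NonNegReal-cancel-φ p q
    (go k q (p + q) (subst NonNegCoords (shift (φ ^ k) p q) h))
    where
    shift : ∀ u p q → (φ ⊠ u) ⊠ ⟨ p , q ⟩ ≡ u ⊠ ⟨ q , p + q ⟩
    shift ⟨ a , b ⟩ p q = ≡-⟨,⟩ (solve (a ∷ b ∷ p ∷ q ∷ [])) (solve (a ∷ b ∷ p ∷ q ∷ []))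

0≼-fromℤ : ∀ {p} → 0≼ fromℤ p → 0ℤ ≤ p
0≼-fromℤ {p} h with 0≼-sound h
... | both-nonneg 0≤p _ = 0≤p
... | p-dominates 0≤p _ _ = 0≤p
... | qφ-dominates _ _ p²≤0 = square-nonpos p (0≤-by (≤0⇒0≤- p²≤0) (solve (p ∷ [])))
  where
  square-nonpos : ∀ p → 0ℤ ≤ - (p * p) → 0ℤ ≤ p
  square-nonpos (+ m) _ = 0≤+ m
  square-nonpos -[1+ _ ] ()

-- The comparisons leφ and leC

≤ᵇ-square : ∀ {A B} n → B ℕ.≤ A →
            T ((A ℕ.∸ B) ℕ.^ 2 ℕ.≤ᵇ 5 ℕ.* n ℕ.^ 2) ⇔ (+ A - + B) * (+ A - + B) ≤ + 5 * (+ n * + n)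
≤ᵇ-square {A} {B} n B≤A = mk⇔
  (λ t → subst₂ _≤_ lhs rhs (+≤+ (ℕ.≤ᵇ⇒≤ _ _ t)))
  (λ le → ℕ.≤⇒≤ᵇ (ℤ.drop‿+≤+ (subst₂ _≤_ (sym lhs) (sym rhs) le)))
  where
  lhs : + ((A ℕ.∸ B) ℕ.^ 2) ≡ (+ A - + B) * (+ A - + B)
  lhs = trans (pos-square (A ℕ.∸ B)) (cong₂ _*_ (pos-∸ B≤A) (pos-∸ B≤A))
  rhs : + (5 ℕ.* n ℕ.^ 2) ≡ + 5 * (+ n * + n)
  rhs = trans (ℤ.pos-* 5 (n ℕ.^ 2)) (cong (+ 5 *_) (pos-square n))

0≼⇒leφ : ∀ k n → 0≼ ⟨ - + k , + n ⟩ → T (leφ k n)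
0≼⇒leφ zero n _ = tt
0≼⇒leφ k@(suc _) n h with 0≼-sound h
... | both-nonneg () _
... | p-dominates () _ _
... | qφ-dominates _ _ N≤0 with 2 ℕ.* k ℕ.≤? n
...   | yes 2k≤n = Equivalence.from T-∨ (inj₁ (ℕ.≤⇒≤ᵇ 2k≤n))
...   | no 2k≰n = Equivalence.from T-∨ (inj₂ (Equivalence.from (≤ᵇ-square n n≤2k)
          (subst (λ z → (z - + n) * (z - + n) ≤ + 5 * (+ n * + n)) (sym (ℤ.pos-* 2 k))
            (square-bound (+ k) (+ n) N≤0))))
  where
  square-bound : ∀ K N → (- K) * (- K) + (- K) * N - N * N ≤ 0ℤ →
                 (+ 2 * K - N) * (+ 2 * K - N) ≤ + 5 * (N * N)
  square-bound K N h = ℤ.0≤i-j⇒j≤i (0≤-by (0≤-* (0≤+ 4) (≤0⇒0≤- h)) (solve (K ∷ N ∷ [])))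
  n≤2k : n ℕ.≤ 2 ℕ.* k
  n≤2k = ℕ.<⇒≤ (ℕ.≰⇒> 2k≰n)

leC-split : ∀ M N → T (leC M N) →
            T (10 ℕ.* M ℕ.≤ᵇ 5 ℕ.* N) ⊎ T ((10 ℕ.* M ℕ.∸ 5 ℕ.* N) ℕ.^ 2 ℕ.≤ᵇ 5 ℕ.* N ℕ.^ 2)
leC-split M N = Equivalence.to T-∨

-- 5M ≥ (φ + 2)N + 1 is incompatible with 10M - 5N ≤ √5 N; the second case
-- uses that 10M - 5N is a multiple of 5.
NonNegReal⇒¬leC : ∀ M N → NonNegReal (+ 5 * M - + 2 * N - + 1) (- N) → 0ℤ ≤ N - + 1 →
  0ℤ ≤ + 5 * N - + 10 * M ⊎
  (0ℤ ≤ + 2 * M - (N + + 1) × 0ℤ ≤ + 5 * (N * N) - (+ 10 * M - + 5 * N) * (+ 10 * M - + 5 * N)) → ⊥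
NonNegReal⇒¬leC M N (both-nonneg _ 0≤-N) 1≤N _ =
  0≤-absurd {n = 0} (0≤-+ 0≤-N 1≤N) (solve (N ∷ []))
NonNegReal⇒¬leC M N (qφ-dominates _ 0≤-N _) 1≤N _ =
  0≤-absurd {n = 0} (0≤-+ 0≤-N 1≤N) (solve (N ∷ []))
NonNegReal⇒¬leC M N (p-dominates 0≤P _ 0≤norm) 1≤N (inj₁ 0≤-u) = 0≤-absurd {n = 0}
  (0≤-+ (0≤-+ (0≤-+ (0≤-+ 0≤norm (0≤-* 0≤P 0≤P)) (0≤-* 0≤P 0≤-u)) (0≤-* (0≤+ 2) 0≤P))
        (0≤-* 1≤N (0≤-+ 1≤N (0≤+ 2))))
  (solve (M ∷ N ∷ []))
NonNegReal⇒¬leC M N (p-dominates _ _ 0≤norm) _ (inj₂ (0≤v , 0≤5N²-u²)) = 0≤-absurd {n = 15}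
  (0≤-+ (0≤-+ (0≤-* (0≤+ 4) 0≤norm) 0≤5N²-u²) (0≤-* (0≤+ 20) 0≤v))
  (solve (M ∷ N ∷ []))

0≼⇒¬leC : ∀ M N → 0≼ ⟨ + 5 * + M - + 2 * + suc N - + 1 , - + suc N ⟩ → ¬ T (leC M (suc N))
0≼⇒¬leC M N h t = NonNegReal⇒¬leC (+ M) (+ suc N) (0≼-sound h) (0≤+ N) (cases (10 ℕ.* M ℕ.≤? 5 ℕ.* suc N))
  where
  cases : Dec (10 ℕ.* M ℕ.≤ 5 ℕ.* suc N) →
    0ℤ ≤ + 5 * + suc N - + 10 * + M ⊎
    (0ℤ ≤ + 2 * + M - (+ suc N + + 1) ×
     0ℤ ≤ + 5 * (+ suc N * + suc N) - (+ 10 * + M - + 5 * + suc N) * (+ 10 * + M - + 5 * + suc N))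
  cases (yes 10M≤5N) = inj₁
    (subst₂ (λ a b → 0ℤ ≤ a - b) (ℤ.pos-* 5 (suc N)) (ℤ.pos-* 10 M) (ℤ.i≤j⇒0≤j-i (+≤+ 10M≤5N)))
  cases (no 10M≰5N) with leC-split M (suc N) t
  ... | inj₁ 10M≤5N = ⊥-elim (10M≰5N (ℕ.≤ᵇ⇒≤ (10 ℕ.* M) (5 ℕ.* suc N) 10M≤5N))
  ... | inj₂ u²≤5N² = inj₂
    ( subst (λ a → 0ℤ ≤ a - (+ suc N + + 1)) (ℤ.pos-* 2 M) (ℤ.i≤j⇒0≤j-i (+≤+ N+1≤2M))
    , ℤ.i≤j⇒0≤j-i (subst₂ (λ a b → (a - b) * (a - b) ≤ + 5 * (+ suc N * + suc N))
        (ℤ.pos-* 10 M) (ℤ.pos-* 5 (suc N))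
        (Equivalence.to (≤ᵇ-square (suc N) (ℕ.<⇒≤ 5N<10M)) u²≤5N²)) )
    where
    5N<10M : 5 ℕ.* suc N ℕ.< 10 ℕ.* M
    5N<10M = ℕ.≰⇒> 10M≰5N
    N+1≤2M : suc N ℕ.+ 1 ℕ.≤ 2 ℕ.* M
    N+1≤2M = subst (ℕ._≤ 2 ℕ.* M) (ℕ.+-comm 1 (suc N))
      (ℕ.*-cancelˡ-< 5 (suc N) (2 ℕ.* M) (subst (5 ℕ.* suc N ℕ.<_) (ℕ.*-assoc 5 2 M) 5N<10M))

-- Fibonacci numbers and the recursion for a

fib-suc-mono : ∀ n → fib n ℕ.≤ fib (suc n)
fib-suc-mono zero = z≤n
fib-suc-mono (suc n) = ℕ.m≤m+n (fib (suc n)) (fib n)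

fib-mono : ∀ {m n} → m ℕ.≤ n → fib m ℕ.≤ fib n
fib-mono m≤n = go (ℕ.≤⇒≤′ m≤n)
  where
  go : ∀ {m n} → m ≤′ n → fib m ℕ.≤ fib n
  go ≤′-refl = ℕ.≤-refl
  go (≤′-step {n} m≤n) = ℕ.≤-trans (go m≤n) (fib-suc-mono n)

fib-<-reflect : ∀ {m n} → fib m ℕ.< fib n → m ℕ.< n
fib-<-reflect lt = ℕ.≰⇒> (λ n≤m → ℕ.<⇒≱ lt (fib-mono n≤m))

fib-pos : ∀ n → 1 ℕ.≤ fib (suc n)
fib-pos zero = s≤s z≤n
fib-pos (suc n) = ℕ.≤-trans (fib-pos n) (fib-suc-mono (suc n))

n≤fib : ∀ n → n ℕ.≤ fib (suc n)
n≤fib zero = z≤n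
n≤fib (suc zero) = s≤s z≤n
n≤fib (suc (suc n)) = subst (ℕ._≤ fib (3 ℕ.+ n)) (ℕ.+-comm (suc n) 1)
  (ℕ.+-mono-≤ (n≤fib (suc n)) (fib-pos n))

fib-block-unique : ∀ {j k n} → fib j ℕ.< n → n ℕ.≤ fib (suc j) →
                   fib k ℕ.< n → n ℕ.≤ fib (suc k) → j ≡ k
fib-block-unique {j} {k} Fj<n n≤Fj₁ Fk<n n≤Fk₁ with ℕ.<-cmp j k
... | tri< j<k _ _ = ⊥-elim (ℕ.<⇒≱ Fk<n (ℕ.≤-trans n≤Fj₁ (fib-mono j<k)))
... | tri≈ _ j≡k _ = j≡k
... | tri> _ _ k<j = ⊥-elim (ℕ.<⇒≱ Fj<n (ℕ.≤-trans n≤Fk₁ (fib-mono k<j)))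

findJ-spec : ∀ f n j → fib j ℕ.< n → n ℕ.≤ fib (f ℕ.+ j) →
             j ℕ.≤ findJ f n j × fib (findJ f n j) ℕ.< n × n ℕ.≤ fib (suc (findJ f n j))
findJ-spec zero n j Fj<n n≤Fj = ⊥-elim (ℕ.<⇒≱ Fj<n n≤Fj)
findJ-spec (suc f) n j Fj<n n≤F with n ℕ.≤ᵇ fib (suc j) in eq
... | true = ℕ.≤-refl , Fj<n , ℕ.≤ᵇ⇒≤ n (fib (suc j)) (subst T (sym eq) tt)
... | false with findJ-spec f n (suc j) Fj₁<n (subst (λ r → n ℕ.≤ fib r) (sym (ℕ.+-suc f j)) n≤F)
  where
  Fj₁<n : fib (suc j) ℕ.< n
  Fj₁<n = ℕ.≰⇒> (λ n≤Fj₁ → subst T eq (ℕ.≤⇒≤ᵇ n≤Fj₁))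
...   | j<j′ , Fj′<n , n≤Fj′₁ = ℕ.≤-trans (ℕ.n≤1+n j) j<j′ , Fj′<n , n≤Fj′₁

jOf-spec : ∀ n → 2 ℕ.≤ n → 2 ℕ.≤ jOf n × fib (jOf n) ℕ.< n × n ℕ.≤ fib (suc (jOf n))
jOf-spec n 2≤n = findJ-spec (suc n) n 2 2≤n
  (ℕ.≤-trans (n≤fib n) (fib-mono (s≤s (ℕ.m≤m+n n 2))))

jOf-remainder< : ∀ n → 2 ℕ.≤ n → n ℕ.∸ fib (jOf n) ℕ.< n
jOf-remainder< n 2≤n with jOf-spec n 2≤n
... | 2≤j , Fj<n , _ = ℕ.∸-monoʳ-< (ℕ.≤-trans (fib-pos 1) (fib-mono 2≤j)) (ℕ.<⇒≤ Fj<n)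

aFuel-stable : ∀ f g n → n ℕ.< f → n ℕ.< g → aFuel f n ≡ aFuel g n
aFuel-stable (suc f) (suc g) zero _ _ = refl
aFuel-stable (suc f) (suc g) (suc zero) _ _ = refl
aFuel-stable (suc f) (suc g) n@(suc (suc _)) (s≤s n≤f) (s≤s n≤g) =
  cong (λ x → + fib (suc (jOf n)) - x)
    (aFuel-stable f g _ (ℕ.<-≤-trans (jOf-remainder< n 2≤n) n≤f)
                        (ℕ.<-≤-trans (jOf-remainder< n 2≤n) n≤g))
  where
  2≤n : 2 ℕ.≤ n
  2≤n = s≤s (s≤s z≤n)

a-unfold : ∀ n → 2 ℕ.≤ n → a n ≡ + fib (suc (jOf n)) - a (n ℕ.∸ fib (jOf n))
a-unfold (suc zero) (s≤s ())
a-unfold n@(suc (suc _)) 2≤n =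
  cong (λ x → + fib (suc (jOf n)) - x) (aFuel-stable _ _ _ (jOf-remainder< n 2≤n) ℕ.≤-refl)

a-rec : ∀ i m → 1 ℕ.≤ m → m ℕ.≤ fib (suc i) → a (fib (2 ℕ.+ i) ℕ.+ m) ≡ + fib (3 ℕ.+ i) - a m
a-rec i m 1≤m m≤F = begin
  a n
    ≡⟨ a-unfold n 2≤n ⟩
  + fib (suc (jOf n)) - a (n ℕ.∸ fib (jOf n))
    ≡⟨ cong (λ j → + fib (suc j) - a (n ℕ.∸ fib j)) jOf-n ⟩
  + fib (3 ℕ.+ i) - a (n ℕ.∸ fib (2 ℕ.+ i))
    ≡⟨ cong (λ x → + fib (3 ℕ.+ i) - a x) (ℕ.m+n∸m≡n (fib (2 ℕ.+ i)) m) ⟩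
  + fib (3 ℕ.+ i) - a m
    ∎
  where
  open ≡-Reasoning
  n : ℕ
  n = fib (2 ℕ.+ i) ℕ.+ m
  2≤n : 2 ℕ.≤ n
  2≤n = ℕ.+-mono-≤ (fib-pos (suc i)) 1≤m
  jOf-n : jOf n ≡ 2 ℕ.+ i
  jOf-n with jOf-spec n 2≤n
  ... | _ , Fj<n , n≤Fj₁ = fib-block-unique Fj<n n≤Fj₁
    (ℕ.m<m+n (fib (2 ℕ.+ i)) 1≤m) (ℕ.+-monoʳ-≤ (fib (2 ℕ.+ i)) m≤F)

-- fib+ i m is the case F_j < n ≤ F_(j+1), j = i + 2, of the definition of a.
data FibSplit : ℕ → Set where
  split-0 : FibSplit 0
  split-1 : FibSplit 1
  fib+ : ∀ i m → 1 ℕ.≤ m → m ℕ.≤ fib (suc i) → FibSplit (fib (2 ℕ.+ i) ℕ.+ m)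

fibSplit : ∀ n → FibSplit n
fibSplit zero = split-0
fibSplit (suc zero) = split-1
fibSplit n@(suc (suc _)) with jOf n | jOf-spec n (s≤s (s≤s z≤n))
... | suc zero | s≤s () , _
... | suc (suc i) | _ , Fj<n , n≤Fj₁ =
  subst FibSplit (ℕ.m+[n∸m]≡n (ℕ.<⇒≤ Fj<n))
    (fib+ i (n ℕ.∸ fib (2 ℕ.+ i)) (ℕ.m<n⇒0<n∸m Fj<n) (ℕ.m≤n+o⇒m∸n≤o n (fib (2 ℕ.+ i)) n≤Fj₁))

0≼-φ⁻¹^ : ∀ t → 0≼ φ⁻¹ ^ t
0≼-φ⁻¹^ zero = 0≼-coords (0≤+ _ , 0≤+ _)
0≼-φ⁻¹^ (suc t) = 0≼-⊠ (1 , 0≤+ _ , 0≤+ _) (0≼-φ⁻¹^ t)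

φ⁻¹^-suc-≼ : ∀ t → φ⁻¹ ^ suc t ≼ φ⁻¹ ^ t
φ⁻¹^-suc-≼ t = from-0≼ (subst 0≼_ (φ⁻²≡1-φ⁻¹ (φ⁻¹ ^ t)) (0≼-φ⁻¹^ (2 ℕ.+ t)))
  where
  φ⁻²≡1-φ⁻¹ : ∀ x → φ⁻¹ ⊠ (φ⁻¹ ⊠ x) ≡ x ⊟ φ⁻¹ ⊠ x
  φ⁻²≡1-φ⁻¹ ⟨ p , q ⟩ = ≡-⟨,⟩ (solve (p ∷ q ∷ [])) (solve (p ∷ q ∷ []))

φ⁻¹^-antitone : ∀ {s t} → s ℕ.≤ t → φ⁻¹ ^ t ≼ φ⁻¹ ^ s
φ⁻¹^-antitone s≤t = go (ℕ.≤⇒≤′ s≤t)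
  where
  go : ∀ {s t} → s ≤′ t → φ⁻¹ ^ t ≼ φ⁻¹ ^ s
  go ≤′-refl = ≼-reflexive refl
  go (≤′-step {t} s≤t) = ≼-trans (φ⁻¹^-suc-≼ t) (go s≤t)

φ⁻¹^≼1 : ∀ t → φ⁻¹ ^ t ≼ 1φ
φ⁻¹^≼1 t = φ⁻¹^-antitone {t = t} z≤n

ψ^-binet : ∀ j → ψ ^ j ≡ ⟨ + fib (suc j) , - + fib j ⟩
ψ^-binet zero = refl
ψ^-binet (suc j) = trans (cong (ψ ⊠_) (ψ^-binet j)) (step (+ fib (suc j)) (+ fib j))
  where
  step : ∀ b a → ψ ⊠ ⟨ b , - a ⟩ ≡ ⟨ b + a , - b ⟩
  step b a = ≡-⟨,⟩ (solve (a ∷ b ∷ [])) (solve (a ∷ b ∷ []))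

ψ^-sign : ∀ j → ψ ^ j ≡ φ⁻¹ ^ j ⊎ ψ ^ j ≡ ⊟ φ⁻¹ ^ j
ψ^-sign zero = inj₁ refl
ψ^-sign (suc j) with ψ^-sign j
... | inj₁ ψ^j≡ = inj₂ (trans (cong (ψ ⊠_) ψ^j≡) (ψ≡-φ⁻¹ (φ⁻¹ ^ j)))
  where
  ψ≡-φ⁻¹ : ∀ x → ψ ⊠ x ≡ ⊟ (φ⁻¹ ⊠ x)
  ψ≡-φ⁻¹ ⟨ p , q ⟩ = ≡-⟨,⟩ (solve (p ∷ q ∷ [])) (solve (p ∷ q ∷ []))
... | inj₂ ψ^j≡ = inj₁ (trans (cong (ψ ⊠_) ψ^j≡) (ψ⊟≡φ⁻¹ (φ⁻¹ ^ j)))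
  where
  ψ⊟≡φ⁻¹ : ∀ x → ψ ⊠ ⊟ x ≡ φ⁻¹ ⊠ x
  ψ⊟≡φ⁻¹ ⟨ p , q ⟩ = ≡-⟨,⟩ (solve (p ∷ q ∷ [])) (solve (p ∷ q ∷ []))

ψ^≼φ : ∀ j → ψ ^ j ≼ φ
ψ^≼φ j = ≼-trans ψ^j≼φ⁻¹^j (≼-trans (φ⁻¹^≼1 j) (from-0≼ (1 , 0≤+ 1 , 0≤+ 0)))
  where
  ψ^j≼φ⁻¹^j : ψ ^ j ≼ φ⁻¹ ^ j
  ψ^j≼φ⁻¹^j with ψ^-sign j
  ... | inj₁ ψ^j≡ = ≼-reflexive ψ^j≡
  ... | inj₂ ψ^j≡ = subst (_≼ φ⁻¹ ^ j) (sym ψ^j≡)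
    (from-0≼ (subst 0≼_ (double (φ⁻¹ ^ j)) (0≼-⊞ (0≼-φ⁻¹^ j) (0≼-φ⁻¹^ j))))
    where
    double : ∀ x → x ⊞ x ≡ x ⊟ ⊟ x
    double ⟨ p , q ⟩ = ≡-⟨,⟩ (solve (p ∷ [])) (solve (q ∷ []))

-- The lower bound

-- 5z - (φ + 2)n = 5(z - cn), with c = (φ + 2)/5 the constant of the lower bound.
excess : ℤ → ℤ → ℤ[φ]
excess z n = ⟨ + 5 * z - + 2 * n , - n ⟩

excess-⊞ : ∀ z z′ n n′ → excess (z + z′) (n + n′) ≡ excess z n ⊞ excess z′ n′
excess-⊞ z z′ n n′ = ≡-⟨,⟩ (solve (z ∷ z′ ∷ n ∷ n′ ∷ [])) (solve (n ∷ n′ ∷ []))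

fibExcess fibExcess′ : ℕ → ℤ[φ]
fibExcess j = excess (+ fib (suc j)) (+ fib j)
fibExcess′ j = excess (+ fib (suc j)) (- + fib j)

fibExcess-rec : ∀ j → fibExcess (2 ℕ.+ j) ≡ fibExcess (suc j) ⊞ fibExcess j
fibExcess-rec j = excess-⊞ (+ fib (2 ℕ.+ j)) (+ fib (suc j)) (+ fib (suc j)) (+ fib j)

0≼-fibExcess : ∀ j → 0≼ fibExcess j
0≼-fibExcess zero = 0≼-coords (0≤+ _ , 0≤+ _)
0≼-fibExcess (suc zero) = 2 , 0≤+ _ , 0≤+ _
0≼-fibExcess (suc (suc j)) =
  subst 0≼_ (sym (fibExcess-rec j)) (0≼-⊞ (0≼-fibExcess (suc j)) (0≼-fibExcess j))

fibExcess-suc-≼ : ∀ i → fibExcess (suc i) ≼ fibExcess (2 ℕ.+ i)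
fibExcess-suc-≼ i = subst (fibExcess (suc i) ≼_) (sym (fibExcess-rec i)) (≼-⊞ʳ (0≼-fibExcess i))

fibExcess-mono : ∀ {j j′} → suc j ℕ.≤ j′ → fibExcess (suc j) ≼ fibExcess j′
fibExcess-mono j<j′ = go (ℕ.≤⇒≤′ j<j′)
  where
  go : ∀ {j j′} → suc j ≤′ j′ → fibExcess (suc j) ≼ fibExcess j′
  go ≤′-refl = ≼-reflexive refl
  go (≤′-step {zero} j<0) = ⊥-elim (ℕ.n≮0 (ℕ.≤′⇒≤ j<0))
  go (≤′-step {suc i} j<i) = ≼-trans (go j<i) (fibExcess-suc-≼ i)

fibExcess-golden : ∀ j → fibExcess (2 ℕ.+ j) ⊟ fibExcess′ j ≡ ⟨ + 2 , + 1 ⟩ ⊠ ψ ^ (2 ℕ.+ j)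
fibExcess-golden j = trans (identity (+ fib j) (+ fib (suc j))) (cong (⟨ + 2 , + 1 ⟩ ⊠_) (sym (ψ^-binet (2 ℕ.+ j))))
  where
  identity : ∀ a b → excess (b + a + b) (b + a) ⊟ excess b (- a) ≡ ⟨ + 2 , + 1 ⟩ ⊠ ⟨ b + a + b , - (b + a) ⟩
  identity a b = ≡-⟨,⟩ (solve (a ∷ b ∷ [])) (solve (a ∷ b ∷ []))

-- φ⁴ = 3φ + 2 ≥ 3 + φ, which absorbs the worst case ψ^(k+4) = -φ^-(k+4).
golden-margin : ∀ k → φ⁻¹ ^ (4 ℕ.+ k) ≼ fibExcess (4 ℕ.+ k) ⊟ fibExcess′ (2 ℕ.+ k) ⊞ φ⁻¹ ^ k
golden-margin k = begin
  e
    ∼⟨ by-sign (ψ^-sign (4 ℕ.+ k)) ⟩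
  ⟨ + 2 , + 1 ⟩ ⊠ ψ ^ (4 ℕ.+ k) ⊞ φ ^ 4 ⊠ e
    ≡⟨ cong₂ _⊞_ (fibExcess-golden (2 ℕ.+ k)) (φ⁻¹^-shift (φ⁻¹ ^ k)) ⟨
  fibExcess (4 ℕ.+ k) ⊟ fibExcess′ (2 ℕ.+ k) ⊞ φ⁻¹ ^ k
    ∎
  where
  open Relation.Binary.Reasoning.Preorder ≼-preorder
  e : ℤ[φ]
  e = φ⁻¹ ^ (4 ℕ.+ k)
  φ⁻¹^-shift : ∀ x → x ≡ φ ^ 4 ⊠ (φ⁻¹ ⊠ (φ⁻¹ ⊠ (φ⁻¹ ⊠ (φ⁻¹ ⊠ x))))
  φ⁻¹^-shift ⟨ p , q ⟩ = ≡-⟨,⟩ (solve (p ∷ q ∷ [])) (solve (p ∷ q ∷ []))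
  by-sign : ψ ^ (4 ℕ.+ k) ≡ e ⊎ ψ ^ (4 ℕ.+ k) ≡ ⊟ e →
            e ≼ ⟨ + 2 , + 1 ⟩ ⊠ ψ ^ (4 ℕ.+ k) ⊞ φ ^ 4 ⊠ e
  by-sign (inj₁ ψ^≡e) rewrite ψ^≡e =
    from-0≼ (subst 0≼_ (identity e) (0≼-⊠ (0≼-coords (0≤+ 3 , 0≤+ 4)) (0≼-φ⁻¹^ (4 ℕ.+ k))))
    where
    identity : ∀ x → ⟨ + 3 , + 4 ⟩ ⊠ x ≡ (⟨ + 2 , + 1 ⟩ ⊠ x ⊞ φ ^ 4 ⊠ x) ⊟ x
    identity ⟨ p , q ⟩ = ≡-⟨,⟩ (solve (p ∷ q ∷ [])) (solve (p ∷ q ∷ []))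
  by-sign (inj₂ ψ^≡-e) rewrite ψ^≡-e =
    from-0≼ (subst 0≼_ (identity e) (0≼-⊠ (1 , 0≤+ 2 , 0≤+ 1) (0≼-φ⁻¹^ (4 ℕ.+ k))))
    where
    identity : ∀ x → ⟨ - + 1 , + 2 ⟩ ⊠ x ≡ (⟨ + 2 , + 1 ⟩ ⊠ ⊟ x ⊞ φ ^ 4 ⊠ x) ⊟ x
    identity ⟨ p , q ⟩ = ≡-⟨,⟩ (solve (p ∷ q ∷ [])) (solve (p ∷ q ∷ []))

δ : ℕ → ℤ[φ]
δ n = excess (a n) (+ n) ⊞ fromℤ (+ 4)

δ-one-block : ∀ i → δ (fib (2 ℕ.+ i) ℕ.+ 1) ≡ fibExcess (2 ℕ.+ i) ⊞ ⟨ - + 3 , - + 1 ⟩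
δ-one-block i = trans
  (cong (λ z → excess z (+ fib (2 ℕ.+ i) + + 1) ⊞ fromℤ (+ 4)) (a-rec i 1 ℕ.≤-refl (fib-pos i)))
  (identity (+ fib (3 ℕ.+ i)) (+ fib (2 ℕ.+ i)))
  where
  identity : ∀ F₁ F₀ → excess (F₁ - + 1) (F₀ + + 1) ⊞ fromℤ (+ 4) ≡ excess F₁ F₀ ⊞ ⟨ - + 3 , - + 1 ⟩
  identity F₁ F₀ = ≡-⟨,⟩ (solve (F₁ ∷ F₀ ∷ [])) (solve (F₀ ∷ []))

δ-two-blocks : ∀ i k m → 1 ℕ.≤ m → m ℕ.≤ fib (suc k) → fib (2 ℕ.+ k) ℕ.+ m ℕ.≤ fib (suc i) →
  δ (fib (2 ℕ.+ i) ℕ.+ (fib (2 ℕ.+ k) ℕ.+ m)) ≡ fibExcess (2 ℕ.+ i) ⊟ fibExcess′ (2 ℕ.+ k) ⊞ δ m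
δ-two-blocks i k m 1≤m m≤F m′≤F = begin
  excess (a (Fi ℕ.+ m′)) (+ (Fi ℕ.+ m′)) ⊞ fromℤ (+ 4)
    ≡⟨ cong (λ z → excess z (+ (Fi ℕ.+ m′)) ⊞ fromℤ (+ 4)) a-two-blocks ⟩
  excess (+ fib (3 ℕ.+ i) - (+ fib (3 ℕ.+ k) - a m)) (+ Fi + (+ fib (2 ℕ.+ k) + + m)) ⊞ fromℤ (+ 4)
    ≡⟨ identity (a m) (+ fib (3 ℕ.+ i)) (+ Fi) (+ fib (3 ℕ.+ k)) (+ fib (2 ℕ.+ k)) (+ m) ⟩
  fibExcess (2 ℕ.+ i) ⊟ fibExcess′ (2 ℕ.+ k) ⊞ δ m ∎
  where
  open ≡-Reasoning
  Fi m′ : ℕ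
  Fi = fib (2 ℕ.+ i)
  m′ = fib (2 ℕ.+ k) ℕ.+ m
  a-two-blocks : a (Fi ℕ.+ m′) ≡ + fib (3 ℕ.+ i) - (+ fib (3 ℕ.+ k) - a m)
  a-two-blocks = trans (a-rec i m′ (ℕ.≤-trans 1≤m (ℕ.m≤n+m m _)) m′≤F)
                       (cong (λ x → + fib (3 ℕ.+ i) - x) (a-rec k m 1≤m m≤F))
  identity : ∀ z F₁ F₀ G₁ G₀ M →
    excess (F₁ - (G₁ - z)) (F₀ + (G₀ + M)) ⊞ fromℤ (+ 4) ≡
    excess F₁ F₀ ⊟ excess G₁ (- G₀) ⊞ (excess z M ⊞ fromℤ (+ 4))
  identity z F₁ F₀ G₁ G₀ M =
    ≡-⟨,⟩ (solve (z ∷ F₁ ∷ F₀ ∷ G₁ ∷ G₀ ∷ M ∷ [])) (solve (F₀ ∷ G₀ ∷ M ∷ []))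

one-block-bound : ∀ i → φ⁻¹ ^ (2 ℕ.+ i) ≼ δ (fib (2 ℕ.+ i) ℕ.+ 1)
one-block-bound i = begin
  φ⁻¹ ^ (2 ℕ.+ i)
    ∼⟨ φ⁻¹^≼1 (2 ℕ.+ i) ⟩
  1φ
    ∼⟨ from-0≼ (2 , 0≤+ 2 , 0≤+ 0) ⟩
  fibExcess 2 ⊞ ⟨ - + 3 , - + 1 ⟩
    ∼⟨ ⊞-monoˡ-≼ ⟨ - + 3 , - + 1 ⟩ (fibExcess-mono {j′ = 2 ℕ.+ i} (s≤s (s≤s z≤n))) ⟩
  fibExcess (2 ℕ.+ i) ⊞ ⟨ - + 3 , - + 1 ⟩
    ≡⟨ δ-one-block i ⟨
  δ (fib (2 ℕ.+ i) ℕ.+ 1)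
    ∎
  where open Relation.Binary.Reasoning.Preorder ≼-preorder

two-blocks-bound : ∀ i k m → 1 ℕ.≤ m → m ℕ.≤ fib (suc k) → fib (2 ℕ.+ k) ℕ.+ m ℕ.≤ fib (suc i) →
                   φ⁻¹ ^ k ≼ δ m → φ⁻¹ ^ (2 ℕ.+ i) ≼ δ (fib (2 ℕ.+ i) ℕ.+ (fib (2 ℕ.+ k) ℕ.+ m))
two-blocks-bound i k m 1≤m m≤F block≤F δ-m = begin
  φ⁻¹ ^ (2 ℕ.+ i)
    ∼⟨ φ⁻¹^-antitone 4+k≤2+i ⟩
  φ⁻¹ ^ (4 ℕ.+ k)
    ∼⟨ golden-margin k ⟩
  fibExcess (4 ℕ.+ k) ⊟ fibExcess′ (2 ℕ.+ k) ⊞ φ⁻¹ ^ k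
    ∼⟨ ⊞-mono-≼ (⊞-monoˡ-≼ (⊟ fibExcess′ (2 ℕ.+ k)) (fibExcess-mono 4+k≤2+i)) δ-m ⟩
  fibExcess (2 ℕ.+ i) ⊟ fibExcess′ (2 ℕ.+ k) ⊞ δ m
    ≡⟨ δ-two-blocks i k m 1≤m m≤F block≤F ⟨
  δ (fib (2 ℕ.+ i) ℕ.+ (fib (2 ℕ.+ k) ℕ.+ m))
    ∎
  where
  open Relation.Binary.Reasoning.Preorder ≼-preorder
  4+k≤2+i : 4 ℕ.+ k ℕ.≤ 2 ℕ.+ i
  4+k≤2+i = s≤s (fib-<-reflect (ℕ.<-≤-trans (ℕ.m<m+n (fib (2 ℕ.+ k)) 1≤m) block≤F))

δ-bound : ∀ n t → n ℕ.≤ fib (suc t) → φ⁻¹ ^ t ≼ δ n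
δ-bound = <-rec (λ n → ∀ t → n ℕ.≤ fib (suc t) → φ⁻¹ ^ t ≼ δ n) bound
  where
  bound : ∀ n → (∀ {m} → m ℕ.< n → ∀ t → m ℕ.≤ fib (suc t) → φ⁻¹ ^ t ≼ δ m) →
          ∀ t → n ℕ.≤ fib (suc t) → φ⁻¹ ^ t ≼ δ n
  bound n rec t n≤F with fibSplit n
  ... | split-0 = ≼-trans (φ⁻¹^≼1 t) (from-0≼ (0≼-coords (0≤+ 3 , 0≤+ 0)))
  ... | split-1 = ≼-trans (φ⁻¹^≼1 t) (from-0≼ (2 , 0≤+ 5 , 0≤+ 4))
  ... | fib+ i m 1≤m m≤F = ≼-trans (φ⁻¹^-antitone 2+i≤t) (blocks (fibSplit m) 1≤m m≤F rec)
    where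
    2+i≤t : 2 ℕ.+ i ℕ.≤ t
    2+i≤t = ℕ.s≤s⁻¹ (fib-<-reflect (ℕ.<-≤-trans (ℕ.m<m+n (fib (2 ℕ.+ i)) 1≤m) n≤F))
    blocks : ∀ {m} → FibSplit m → 1 ℕ.≤ m → m ℕ.≤ fib (suc i) →
      (∀ {m′} → m′ ℕ.< fib (2 ℕ.+ i) ℕ.+ m → ∀ t → m′ ℕ.≤ fib (suc t) → φ⁻¹ ^ t ≼ δ m′) →
      φ⁻¹ ^ (2 ℕ.+ i) ≼ δ (fib (2 ℕ.+ i) ℕ.+ m)
    blocks split-1 _ _ _ = one-block-bound i
    blocks (fib+ k m′ 1≤m′ m′≤F) _ block≤F rec =
      two-blocks-bound i k m′ 1≤m′ m′≤F block≤F (rec m′<n k m′≤F)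
      where
      m′<n : m′ ℕ.< fib (2 ℕ.+ i) ℕ.+ (fib (2 ℕ.+ k) ℕ.+ m′)
      m′<n = ℕ.<-≤-trans (ℕ.m<n+m m′ (fib-pos (suc k))) (ℕ.m≤n+m _ (fib (2 ℕ.+ i)))

0≼-δ : ∀ n → 0≼ δ n
0≼-δ n = 0≼-≼ (0≼-φ⁻¹^ n) (δ-bound n n (n≤fib n))

a-nonneg : ∀ n → 0ℤ ≤ a n
a-nonneg n = 0≤5i+4⇒0≤i (a n) (0≼-fromℤ (subst 0≼_ (identity (a n) (+ n))
  (0≼-⊞ (0≼-δ n) (0≼-coords (0≤-* (0≤+ 2) (0≤+ n) , 0≤+ n)))))
  where
  identity : ∀ z N → excess z N ⊞ fromℤ (+ 4) ⊞ ⟨ + 2 * N , N ⟩ ≡ fromℤ (+ 5 * z + + 4)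
  identity z N = ≡-⟨,⟩ (solve (z ∷ N ∷ [])) (solve (N ∷ []))

a≤φn : ∀ n → 0≼ ⟨ - a n , + n ⟩
a≤φn n with fibSplit n
... | split-0 = 0≼-coords (0≤+ _ , 0≤+ _)
... | split-1 = 1 , 0≤+ _ , 0≤+ _
... | fib+ i m 1≤m m≤F = subst 0≼_ (sym eq)
  (0≼-⊞ (0≼-coords (a-nonneg m , ℤ.i≤j⇒0≤j-i (+≤+ 1≤m))) (_≼_.to-0≼ (ψ^≼φ (2 ℕ.+ i))))
  where
  identity : ∀ z F₁ F₀ M → ⟨ - (F₁ - z) , F₀ + M ⟩ ≡ ⟨ z , M - + 1 ⟩ ⊞ (φ ⊟ ⟨ F₁ , - F₀ ⟩)
  identity z F₁ F₀ M = ≡-⟨,⟩ (solve (z ∷ F₁ ∷ F₀ ∷ [])) (solve (F₀ ∷ M ∷ []))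
  eq : ⟨ - a (fib (2 ℕ.+ i) ℕ.+ m) , + (fib (2 ℕ.+ i) ℕ.+ m) ⟩ ≡ ⟨ a m , + m - + 1 ⟩ ⊞ (φ ⊟ ψ ^ (2 ℕ.+ i))
  eq = begin
    ⟨ - a (fib (2 ℕ.+ i) ℕ.+ m) , + (fib (2 ℕ.+ i) ℕ.+ m) ⟩
      ≡⟨ cong (λ z → ⟨ - z , + (fib (2 ℕ.+ i) ℕ.+ m) ⟩) (a-rec i m 1≤m m≤F) ⟩
    ⟨ - (+ fib (3 ℕ.+ i) - a m) , + fib (2 ℕ.+ i) + + m ⟩
      ≡⟨ identity (a m) (+ fib (3 ℕ.+ i)) (+ fib (2 ℕ.+ i)) (+ m) ⟩
    ⟨ a m , + m - + 1 ⟩ ⊞ (φ ⊟ ⟨ + fib (3 ℕ.+ i) , - + fib (2 ℕ.+ i) ⟩)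
      ≡⟨ cong (λ y → ⟨ a m , + m - + 1 ⟩ ⊞ (φ ⊟ y)) (sym (ψ^-binet (2 ℕ.+ i))) ⟩
    ⟨ a m , + m - + 1 ⟩ ⊞ (φ ⊟ ψ ^ (2 ℕ.+ i))
      ∎
    where open ≡-Reasoning

largestBelow-≥ : ∀ p B k → T (p k) → k ℕ.≤ B → k ℕ.≤ largestBelow p B
largestBelow-≥ p zero k _ z≤n = z≤n
largestBelow-≥ p (suc B) k pk k≤B with p (suc B) in eq
... | true = k≤B
... | false with ℕ.m≤n⇒m<n∨m≡n k≤B
...   | inj₁ k<B = largestBelow-≥ p B k pk (ℕ.s≤s⁻¹ k<B)
...   | inj₂ refl = ⊥-elim (subst T eq pk)

largestBelow-spec : ∀ p B → largestBelow p B ≡ 0 ⊎ T (p (largestBelow p B))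
largestBelow-spec p zero = inj₁ refl
largestBelow-spec p (suc B) with p (suc B) in eq
... | true = inj₂ (subst T (sym eq) tt)
... | false = largestBelow-spec p B

a≡+∣a∣ : ∀ n → a n ≡ + ℤ.∣ a n ∣
a≡+∣a∣ n = sym (ℤ.0≤i⇒+∣i∣≡i (a-nonneg n))

upper-bound : ∀ n → a n ≤ + floorφ n
upper-bound n = subst (_≤ + floorφ n) (sym (a≡+∣a∣ n))
  (+≤+ (largestBelow-≥ (λ m → leφ m n) (2 ℕ.* n) k (0≼⇒leφ k n k≤φn) k≤2n))
  where
  k : ℕ
  k = ℤ.∣ a n ∣
  k≤φn : 0≼ ⟨ - + k , + n ⟩
  k≤φn = subst (λ z → 0≼ ⟨ - z , + n ⟩) (a≡+∣a∣ n) (a≤φn n)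
  identity : ∀ K N → ⟨ - K , N ⟩ ⊞ fromℤ N ⊠ ⟨ + 2 , - + 1 ⟩ ≡ fromℤ (+ 2 * N - K)
  identity K N = ≡-⟨,⟩ (solve (K ∷ N ∷ [])) (solve (N ∷ []))
  2n-k≥0 : 0≼ fromℤ (+ 2 * + n - + k)
  2n-k≥0 = subst 0≼_ (identity (+ k) (+ n))
    (0≼-⊞ k≤φn (0≼-⊠ (0≼-coords (0≤+ n , 0≤+ 0)) (2 , 0≤+ 1 , 0≤+ 0)))
  k≤2n : k ℕ.≤ 2 ℕ.* n
  k≤2n = ℤ.drop‿+≤+ (subst (+ k ≤_) (sym (ℤ.pos-* 2 n)) (ℤ.0≤i-j⇒j≤i (0≼-fromℤ 2n-k≥0)))

lower-bound : ∀ n → + floorC n ≤ a n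
lower-bound zero = 0≤+ 0
lower-bound n@(suc N) with largestBelow-spec (λ m → leC m n) n
... | inj₁ M≡0 = subst (λ M → + M ≤ a n) (sym M≡0) (a-nonneg n)
... | inj₂ leC-M = subst (+ M ≤_) (sym (a≡+∣a∣ n))
  (+≤+ (ℕ.≮⇒≥ (λ k<M → 0≼⇒¬leC M N (excess-gap k<M) leC-M)))
  where
  M k : ℕ
  M = floorC n
  k = ℤ.∣ a n ∣
  identity : ∀ K N D → excess K N ⊞ fromℤ (+ 4) ⊞ fromℤ (+ 5 * D) ≡
                       ⟨ + 5 * (+ 1 + K + D) - + 2 * N - + 1 , - N ⟩
  identity K N D = ≡-⟨,⟩ (solve (K ∷ N ∷ D ∷ [])) (solve (N ∷ []))
  excess-gap : k ℕ.< M → 0≼ ⟨ + 5 * + M - + 2 * + n - + 1 , - + n ⟩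
  excess-gap k<M = subst 0≼_ eq (0≼-⊞ (0≼-δ n) (0≼-coords (0≤-* (0≤+ 5) (0≤+ d) , 0≤+ 0)))
    where
    d : ℕ
    d = M ℕ.∸ suc k
    eq : δ n ⊞ fromℤ (+ 5 * + d) ≡ ⟨ + 5 * + M - + 2 * + n - + 1 , - + n ⟩
    eq = begin
      δ n ⊞ fromℤ (+ 5 * + d)
        ≡⟨ cong (λ z → excess z (+ n) ⊞ fromℤ (+ 4) ⊞ fromℤ (+ 5 * + d)) (a≡+∣a∣ n) ⟩
      excess (+ k) (+ n) ⊞ fromℤ (+ 4) ⊞ fromℤ (+ 5 * + d)
        ≡⟨ identity (+ k) (+ n) (+ d) ⟩
      ⟨ + 5 * + (suc k ℕ.+ d) - + 2 * + n - + 1 , - + n ⟩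
        ≡⟨ cong (λ x → ⟨ + 5 * + x - + 2 * + n - + 1 , - + n ⟩) (ℕ.m+[n∸m]≡n k<M) ⟩
      ⟨ + 5 * + M - + 2 * + n - + 1 , - + n ⟩
        ∎
      where open ≡-Reasoning

proposition6 : (n : ℕ) → (+ floorC n ≤ a n) × (a n ≤ + floorφ n)
proposition6 n = lower-bound n , upper-bound n
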